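{- Let $m$ be a composite natural number. If $m=p^2$ for some prime $p$, then $\alpha(\Gamma_{m\mathbb{Z}}(\mathbb{Z}))=\alpha(\Gamma(\mathbb{Z}/m\mathbb{Z}))=1$. If $m$ is not the square of a prime, then $\alpha(\Gamma_{m\mathbb{Z}}(\mathbb{Z}))=\infty$ (i.e. $\Gamma_{m\mathbb{Z}}(\mathbb{Z})$ has an infinite independent set), whereas $\alpha(\Gamma(\mathbb{Z}/m\mathbb{Z}))$ is finite.
   Context: For a commutative ring $R$ with $1\neq0$ and an ideal $I$ of $R$, the ideal-based zero-divisor graph $\Gamma_I(R)$ is the simple undirected graph with vertex set $\{x\in R\setminus I : xy\in I \text{ for some } y\in R\setminus I\}$, two distinct vertices $x,y$ adjacent iff $xy\in I$. $\Gamma(R)=\Gamma_{0}(R)$ is the zero-divisor graph (vertices the nonzero zero-divisors, $x\sim y$ iff $xy=0$). $\alpha(G)$ is the independence number (supremum of sizes of sets of pairwise non-adjacent vertices), taken to be $\infty$ if there are infinite independent sets. -}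

module Defs where

open import Level using (0ℓ)
open import Data.Nat as ℕ using (ℕ)
open import Data.Nat.Divisibility as ℕD using ()
open import Data.Integer as ℤ using (ℤ; +_)
open import Data.Integer.Divisibility as ℤD using ()
open import Data.Fin using (Fin; toℕ)
open import Data.List using (List; length)
open import Data.List.Relation.Unary.All using (All)
open import Data.List.Relation.Unary.AllPairs using (AllPairs)
open import Data.Product using (Σ; ∃; ∃-syntax; Σ-syntax; _×_)
open import Function.Definitions using (Injective)
open import Relation.Binary.PropositionalEquality using (_≡_; _≢_)
open import Relation.Nullary using (¬_)

record Graph : Set₁ where
  field
    Carrier : Set
    Vertex  : Carrier → Set
    Adj     : Carrier → Carrier → Set

open Graph public

IndependentList : (G : Graph) → List (Carrier G) → Set
IndependentList G xs =
  All (Vertex G) xs × AllPairs (λ x y → x ≢ y × ¬ Adj G x y) xs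

HasIndepNumber : Graph → ℕ → Set
HasIndepNumber G n =
  (∃[ xs ] (IndependentList G xs × length xs ≡ n)) ×
  (∀ xs → IndependentList G xs → length xs ℕ.≤ n)

HasInfiniteIndepSet : Graph → Set
HasInfiniteIndepSet G =
  Σ (ℕ → Carrier G) λ f → (Injective _≡_ _≡_ f × (∀ i → Vertex G (f i)) ×
          (∀ i j → i ≢ j → ¬ Adj G (f i) (f j)))

Γ-mℤ : ℕ → Graph
Γ-mℤ m = record
  { Carrier = ℤ
  ; Vertex  = λ x → ¬ (+ m ℤD.∣ x) × ∃[ y ] (¬ (+ m ℤD.∣ y) × (+ m ℤD.∣ (x ℤ.* y)))
  ; Adj     = λ (x y : ℤ) → x ≢ y × (+ m ℤD.∣ (x ℤ.* y))
  }

-- Γ(ℤ/mℤ): ℤ/mℤ represented by Fin m (residues 0..m-1) with multiplication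
-- mod m; vertices are nonzero zero-divisors, distinct x, y adjacent iff xy = 0.
Γ-ℤmod : ℕ → Graph
Γ-ℤmod m = record
  { Carrier = Fin m
  ; Vertex  = λ x → ¬ (m ℕD.∣ toℕ x) × Σ[ y ∈ Fin m ] (¬ (m ℕD.∣ toℕ y) × (m ℕD.∣ (toℕ x ℕ.* toℕ y)))
  ; Adj     = λ (x y : Fin m) → x ≢ y × (m ℕD.∣ (toℕ x ℕ.* toℕ y))
  }

-- If m = p², every vertex of either graph is a multiple of p, so any two
-- distinct vertices have product divisible by p²: the graphs are complete and
-- α = 1 (the vertex p exists). Otherwise write m = q d with d a prime factor;
-- then m ∤ q and m ∤ d², and the numbers d (1 + i m) are vertices (annihilated by q)
-- whose pairwise products are all congruent to d² modulo m, hence never in mℤ.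
-- Finally Γ(ℤ/mℤ) lives on the finite set Fin m, where independent lists are
-- duplicate-free, so their lengths are bounded by m and a longest one can be
-- found by exhaustive search.
module Submission where

open import Defs
open import Data.Nat using (ℕ; _*_)
open import Data.Nat.Primality using (Prime; Composite)
open import Data.Product using (∃-syntax; _×_)
open import Relation.Binary.PropositionalEquality using (_≡_)
open import Relation.Nullary using (¬_)

open import Level using (0ℓ)
open import Data.Nat.Base using (zero; suc; _+_; _≤_; _<_; z≤n; s≤s; NonZero; ≢-nonZero; nonTrivial⇒n>1; nonTrivial⇒≢1; nonTrivial⇒nonZero)
open import Data.Nat.Properties using (suc-injective; *-cancelˡ-≡; *-cancelʳ-≡; m*n≡0⇒m≡0; m<m*n; <⇒≱; ≤-pred; m≤n⇒m<n∨m≡n; *-assoc; *-identityˡ; *-identityʳ)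
open import Data.Nat.Divisibility using (_∣_; divides; _∣?_; _∣0; ∣-refl; ∣-trans; ∣1⇒≡1; m∣m*n; n∣m*n; ∣m+n∣m⇒∣n; *-pres-∣; *-monoˡ-∣; *-cancelˡ-∣; *-cancelʳ-∣; ∣⇒≤; quotient-<; quotient≢0)
open import Data.Nat.Primality using (euclidsLemma; prime⇒nonZero; prime⇒nonTrivial; prime⇒irreducible; composite⇒nonTrivial; composite⇒¬prime)
open import Data.Nat.Primality.Factorisation using (factorise; module PrimeFactorisation)
open import Data.Nat.ListAction using (product)
open import Data.Nat.Solver using (module +-*-Solver)
open import Data.Integer as ℤ using (ℤ; +_)
open import Data.Integer.Properties using (abs-*; +-injective)
open import Data.Fin using (Fin; toℕ; fromℕ<) renaming (zero to fzero; suc to fsuc)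
open import Data.Fin.Properties using (_≟_; any?; injective⇒≤; toℕ-fromℕ<)
open import Data.List using (List; []; _∷_; length; lookup)
open import Data.List.Membership.Propositional.Properties using (∈-lookup)
open import Data.List.Relation.Unary.All as All using (All; []; _∷_)
open import Data.List.Relation.Unary.AllPairs as AllPairs using ([]; _∷_)
open import Data.List.Relation.Unary.Unique.Propositional using (Unique)
open import Data.Product using (∃₂; _,_; proj₁)
open import Data.Sum as Sum using (_⊎_; inj₁; inj₂)
open import Data.Empty using (⊥-elim)
open import Function.Base using (_∘_)
open import Function.Definitions using (Injective)
open import Relation.Binary.PropositionalEquality using (_≢_; refl; sym; trans; cong; subst)
open import Relation.Nullary using (Dec; yes; no; ¬?)
open import Relation.Nullary.Decidable using (_×-dec_)
open import Relation.Unary using (Pred)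

complete⇒hasIndepNumber1 : (G : Graph) {v : Carrier G} → Vertex G v →
  (∀ {x y} → Vertex G x → Vertex G y → x ≢ y → Adj G x y) → HasIndepNumber G 1
complete⇒hasIndepNumber1 G {v} v∈G complete = (v ∷ [] , (v∈G ∷ [] , [] ∷ []) , refl) , bound
  where
  bound : ∀ xs → IndependentList G xs → length xs ≤ 1
  bound []          _ = z≤n
  bound (_ ∷ [])    _ = s≤s z≤n
  bound (_ ∷ _ ∷ _) (x∈G ∷ y∈G ∷ _ , ((x≢y , ¬x~y) ∷ _) ∷ _) = ⊥-elim (¬x~y (complete x∈G y∈G x≢y))

unique⇒lookup-injective : ∀ {A : Set} {xs : List A} → Unique xs → Injective _≡_ _≡_ (lookup xs)
unique⇒lookup-injective (_ ∷ _)      {fzero}  {fzero}  _  = refl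
unique⇒lookup-injective (x∉xs ∷ _)   {fzero}  {fsuc j} eq = ⊥-elim (All.lookup x∉xs (∈-lookup j) eq)
unique⇒lookup-injective (x∉xs ∷ _)   {fsuc i} {fzero}  eq = ⊥-elim (All.lookup x∉xs (∈-lookup i) (sym eq))
unique⇒lookup-injective (_ ∷ unique) {fsuc i} {fsuc j} eq = cong fsuc (unique⇒lookup-injective unique eq)

unique⇒length≤ : ∀ {n} {xs : List (Fin n)} → Unique xs → length xs ≤ n
unique⇒length≤ unique = injective⇒≤ (unique⇒lookup-injective unique)

∃-ofLength? : ∀ {n} (P : Pred (List (Fin n)) 0ℓ) → (∀ xs → Dec (P xs)) →
  ∀ k → Dec (∃[ xs ] (P xs × length xs ≡ k))
∃-ofLength? P P? zero with P? []
... | yes p  = yes ([] , p , refl)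
... | no ¬p = no λ { ([] , p , _) → ¬p p }
∃-ofLength? P P? (suc k) with any? (λ x → ∃-ofLength? (λ xs → P (x ∷ xs)) (λ xs → P? (x ∷ xs)) k)
... | yes (x , xs , p , eq) = yes (x ∷ xs , p , cong suc eq)
... | no ¬p = no λ { (x ∷ xs , p , eq) → ¬p (x , xs , p , suc-injective eq) }

bounded⇒∃-greatest : (Q : Pred ℕ 0ℓ) → (∀ k → Dec (Q k)) → Q 0 →
  ∀ b → (∀ k → Q k → k ≤ b) → ∃[ n ] (Q n × ∀ k → Q k → k ≤ n)
bounded⇒∃-greatest Q Q? q₀ b bounded with Q? b
... | yes q_b = b , q_b , bounded
bounded⇒∃-greatest Q Q? q₀ zero    bounded | no ¬q_b = ⊥-elim (¬q_b q₀)
bounded⇒∃-greatest Q Q? q₀ (suc b) bounded | no ¬q_b = bounded⇒∃-greatest Q Q? q₀ b bounded′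
  where
  bounded′ : ∀ k → Q k → k ≤ b
  bounded′ k q_k with m≤n⇒m<n∨m≡n (bounded k q_k)
  ... | inj₁ k<1+b = ≤-pred k<1+b
  ... | inj₂ refl  = ⊥-elim (¬q_b q_k)

finite⇒hasIndepNumber : ∀ {n} (V : Pred (Fin n) 0ℓ) (A : Fin n → Fin n → Set) →
  (∀ x → Dec (V x)) → (∀ x y → Dec (A x y)) →
  ∃[ k ] HasIndepNumber (record { Carrier = Fin n ; Vertex = V ; Adj = A }) k
finite⇒hasIndepNumber {n} V A V? A? with bounded⇒∃-greatest HasIndepListOfLength
    (∃-ofLength? (IndependentList G) independent?) ([] , ([] , []) , refl) n
    (λ { _ (xs , (_ , pairs) , refl) → unique⇒length≤ (AllPairs.map proj₁ pairs) })
  where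
  G : Graph
  G = record { Carrier = Fin n ; Vertex = V ; Adj = A }

  HasIndepListOfLength : Pred ℕ 0ℓ
  HasIndepListOfLength k = ∃[ xs ] (IndependentList G xs × length xs ≡ k)

  independent? : ∀ xs → Dec (IndependentList G xs)
  independent? = λ xs → All.all? V? xs ×-dec AllPairs.allPairs? (λ x y → ¬? (x ≟ y) ×-dec ¬? (A? x y)) xs
... | k , has-k , greatest = k , has-k , λ xs independent → greatest (length xs) (xs , independent , refl)

Γ-ℤmod-hasIndepNumber : ∀ m → ∃[ n ] HasIndepNumber (Γ-ℤmod m) n
Γ-ℤmod-hasIndepNumber m = finite⇒hasIndepNumber (Vertex (Γ-ℤmod m)) (Adj (Γ-ℤmod m)) vertex? adjacent?
  where
  vertex? : ∀ x → Dec (Vertex (Γ-ℤmod m) x)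
  vertex? x = ¬? (m ∣? toℕ x) ×-dec any? (λ y → ¬? (m ∣? toℕ y) ×-dec (m ∣? toℕ x * toℕ y))

  adjacent? : ∀ x y → Dec (Adj (Γ-ℤmod m) x y)
  adjacent? x y = ¬? (x ≟ y) ×-dec (m ∣? toℕ x * toℕ y)

p*p∣m*n⇒p∣m∨p*p∣n : ∀ {p} m n → Prime p → p * p ∣ m * n → p ∣ m ⊎ p * p ∣ n
p*p∣m*n⇒p∣m∨p*p∣n {p} m n p-prime p*p∣m*n with euclidsLemma m n p-prime (∣-trans (m∣m*n p) p*p∣m*n)
... | inj₁ p∣m = inj₁ p∣m
... | inj₂ (divides c refl) = Sum.map₂ (*-monoˡ-∣ p) (euclidsLemma m c p-prime p∣m*c)
  where
  instance _ = prime⇒nonZero p-prime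
  p∣m*c : p ∣ m * c
  p∣m*c = *-cancelʳ-∣ p (subst (p * p ∣_) (sym (*-assoc m c p)) p*p∣m*n)

prime⇒p*p∤p : ∀ {p} → Prime p → ¬ p * p ∣ p
prime⇒p*p∤p {p} p-prime p*p∣p = nonTrivial⇒≢1 (∣1⇒≡1 (*-cancelˡ-∣ p (subst (p * p ∣_) (sym (*-identityʳ p)) p*p∣p)))
  where
  instance _ = prime⇒nonZero p-prime
  instance _ = prime⇒nonTrivial p-prime

module PrimeSquare {p : ℕ} (p-prime : Prime p) where

  p*p∣m*n∧p*p∤n⇒p∣m : ∀ {m n} → ¬ p * p ∣ n → p * p ∣ m * n → p ∣ m
  p*p∣m*n∧p*p∤n⇒p∣m {m} {n} p*p∤n p*p∣mn = Sum.fromInj₁ (⊥-elim ∘ p*p∤n) (p*p∣m*n⇒p∣m∨p*p∣n m n p-prime p*p∣mn)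

  Γ-mℤ-vertex⇒p∣ : ∀ {x} → Vertex (Γ-mℤ (p * p)) x → p ∣ ℤ.∣ x ∣
  Γ-mℤ-vertex⇒p∣ {x} (_ , y , p*p∤y , p*p∣xy) = p*p∣m*n∧p*p∤n⇒p∣m p*p∤y (subst (p * p ∣_) (abs-* x y) p*p∣xy)

  Γ-mℤ-complete : ∀ {x y} → Vertex (Γ-mℤ (p * p)) x → Vertex (Γ-mℤ (p * p)) y → x ≢ y → Adj (Γ-mℤ (p * p)) x y
  Γ-mℤ-complete {x} {y} x∈Γ y∈Γ x≢y =
    x≢y , subst (p * p ∣_) (sym (abs-* x y)) (*-pres-∣ (Γ-mℤ-vertex⇒p∣ {x} x∈Γ) (Γ-mℤ-vertex⇒p∣ {y} y∈Γ))

  Γ-mℤ-vertex-p : Vertex (Γ-mℤ (p * p)) (+ p)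
  Γ-mℤ-vertex-p = prime⇒p*p∤p p-prime , + p , prime⇒p*p∤p p-prime , subst (p * p ∣_) (sym (abs-* (+ p) (+ p))) ∣-refl

  Γ-ℤmod-vertex⇒p∣ : ∀ {x} → Vertex (Γ-ℤmod (p * p)) x → p ∣ toℕ x
  Γ-ℤmod-vertex⇒p∣ (_ , _ , p*p∤y , p*p∣xy) = p*p∣m*n∧p*p∤n⇒p∣m p*p∤y p*p∣xy

  Γ-ℤmod-complete : ∀ {x y} → Vertex (Γ-ℤmod (p * p)) x → Vertex (Γ-ℤmod (p * p)) y → x ≢ y → Adj (Γ-ℤmod (p * p)) x y
  Γ-ℤmod-complete {x} {y} x∈Γ y∈Γ x≢y = x≢y , *-pres-∣ (Γ-ℤmod-vertex⇒p∣ {x} x∈Γ) (Γ-ℤmod-vertex⇒p∣ {y} y∈Γ)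

  p<p*p : p < p * p
  p<p*p = m<m*n p p {{prime⇒nonZero p-prime}} (nonTrivial⇒n>1 p {{prime⇒nonTrivial p-prime}})

  Γ-ℤmod-vertex-p : Vertex (Γ-ℤmod (p * p)) (fromℕ< p<p*p)
  Γ-ℤmod-vertex-p = p*p∤p̂ , fromℕ< p<p*p , p*p∤p̂ , subst (λ t → p * p ∣ t * t) (sym (toℕ-fromℕ< p<p*p)) ∣-refl
    where
    p*p∤p̂ : ¬ p * p ∣ toℕ (fromℕ< p<p*p)
    p*p∤p̂ = subst (λ t → ¬ p * p ∣ t) (sym (toℕ-fromℕ< p<p*p)) (prime⇒p*p∤p p-prime)

  Γ-mℤ-hasIndepNumber1 : HasIndepNumber (Γ-mℤ (p * p)) 1
  Γ-mℤ-hasIndepNumber1 = complete⇒hasIndepNumber1 (Γ-mℤ (p * p)) {+ p} Γ-mℤ-vertex-p Γ-mℤ-complete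

  Γ-ℤmod-hasIndepNumber1 : HasIndepNumber (Γ-ℤmod (p * p)) 1
  Γ-ℤmod-hasIndepNumber1 = complete⇒hasIndepNumber1 (Γ-ℤmod (p * p)) {fromℕ< p<p*p} Γ-ℤmod-vertex-p Γ-ℤmod-complete

Γ-mℤ-infiniteIndepSet : ∀ {m} q d → m ≡ q * d → ¬ m ∣ q → ¬ m ∣ d * d → HasInfiniteIndepSet (Γ-mℤ m)
Γ-mℤ-infiniteIndepSet {m} q d m≡q*d m∤q m∤d*d = f , f-injective , f-vertex , λ i j _ → f-nonAdjacent i j
  where
  open +-*-Solver

  instance
    d-nonZero : NonZero d
    d-nonZero = ≢-nonZero λ { refl → m∤d*d (m ∣0) }
    m-nonZero : NonZero m
    m-nonZero = ≢-nonZero λ m≡0 → m∤q (subst (m ∣_) (sym (m*n≡0⇒m≡0 q d (trans (sym m≡q*d) m≡0))) (m ∣0))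

  f : ℕ → ℤ
  f i = + (d * suc (i * m))

  f-≡d-mod-m : ∀ i → d * suc (i * m) ≡ m * (d * i) + d
  f-≡d-mod-m i = solve 3 (λ d m i → d :* (con 1 :+ i :* m) := m :* (d :* i) :+ d) refl d m i

  f*f-≡d*d-mod-m : ∀ i j → d * suc (i * m) * (d * suc (j * m)) ≡ m * (d * d * (i + j + i * j * m)) + d * d
  f*f-≡d*d-mod-m i j = solve 4 (λ d m i j → d :* (con 1 :+ i :* m) :* (d :* (con 1 :+ j :* m))
                        := m :* (d :* d :* (i :+ j :+ i :* j :* m)) :+ d :* d) refl d m i j

  f*q-≡0-mod-m : ∀ i → suc (i * m) * m ≡ d * suc (i * m) * q
  f*q-≡0-mod-m i = trans (cong (suc (i * m) *_) m≡q*d) (solve 3 (λ d s q → s :* (q :* d) := d :* s :* q) refl d (suc (i * m)) q)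

  m∣m*k+n⇒m∣n : ∀ {k n} → m ∣ m * k + n → m ∣ n
  m∣m*k+n⇒m∣n {k} m∣m*k+n = ∣m+n∣m⇒∣n m∣m*k+n (m∣m*n k)

  f-injective : Injective _≡_ _≡_ f
  f-injective {i} {j} fi≡fj = *-cancelʳ-≡ i j m (suc-injective (*-cancelˡ-≡ _ _ d (+-injective fi≡fj)))

  f-vertex : ∀ i → Vertex (Γ-mℤ m) (f i)
  f-vertex i = m∤fi , + q , m∤q , subst (m ∣_) (trans (f*q-≡0-mod-m i) (sym (abs-* (f i) (+ q)))) (n∣m*n (suc (i * m)))
    where
    m∤fi : ¬ m ∣ d * suc (i * m)
    m∤fi m∣fi = m∤d*d (∣-trans (m∣m*k+n⇒m∣n (subst (m ∣_) (f-≡d-mod-m i) m∣fi)) (m∣m*n d))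

  f-nonAdjacent : ∀ i j → ¬ Adj (Γ-mℤ m) (f i) (f j)
  f-nonAdjacent i j (_ , m∣fifj) = m∤d*d (m∣m*k+n⇒m∣n (subst (m ∣_) (trans (abs-* (f i) (f j)) (f*f-≡d*d-mod-m i j)) m∣fifj))

prime-factor : ∀ {n} → Composite n → ∃[ p ] (Prime p × p ∣ n)
prime-factor {n} n-composite = go (factors fact) (isFactorisation fact) (factorsPrime fact)
  where
  open PrimeFactorisation
  instance _ = composite⇒nonTrivial n-composite
  fact = factorise n {{nonTrivial⇒nonZero n}}
  go : (ps : List ℕ) → n ≡ product ps → All Prime ps → ∃[ p ] (Prime p × p ∣ n)
  go []       n≡1  _            = ⊥-elim (nonTrivial⇒≢1 n≡1)
  go (p ∷ ps) n≡Πp (p-prime ∷ _) = p , p-prime , subst (p ∣_) (sym n≡Πp) (m∣m*n (product ps))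

composite∧≢p*p⇒split : ∀ {m} → Composite m → ¬ (∃[ p ] (Prime p × m ≡ p * p)) →
  ∃₂ λ q d → m ≡ q * d × ¬ m ∣ q × ¬ m ∣ d * d
composite∧≢p*p⇒split {m} m-composite m≢p*p with prime-factor m-composite
... | p , p-prime , p∣m@(divides q m≡q*p) = q , p , m≡q*p , m∤q , m∤p*p
  where
  instance
    _ = prime⇒nonTrivial p-prime
    _ = nonTrivial⇒nonZero m {{composite⇒nonTrivial m-composite}}

  m∤q : ¬ m ∣ q
  m∤q m∣q = <⇒≱ (quotient-< p∣m) (∣⇒≤ {{quotient≢0 p∣m}} m∣q)

  m∤p*p : ¬ m ∣ p * p
  m∤p*p m∣p*p with prime⇒irreducible p-prime {q} (*-cancelʳ-∣ p {{prime⇒nonZero p-prime}} (subst (_∣ p * p) m≡q*p m∣p*p))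
  ... | inj₁ refl = composite⇒¬prime m-composite (subst Prime (sym (trans m≡q*p (*-identityˡ p))) p-prime)
  ... | inj₂ refl = m≢p*p (p , p-prime , m≡q*p)

lemma15 : (m : ℕ) → Composite m →
    ((∃[ p ] (Prime p × m ≡ p * p)) →
       HasIndepNumber (Γ-mℤ m) 1 × HasIndepNumber (Γ-ℤmod m) 1) ×
    ((¬ (∃[ p ] (Prime p × m ≡ p * p))) →
       HasInfiniteIndepSet (Γ-mℤ m) × ∃[ n ] HasIndepNumber (Γ-ℤmod m) n)
lemma15 m m-composite = primeSquare , notPrimeSquare
  where
  primeSquare : ∃[ p ] (Prime p × m ≡ p * p) → HasIndepNumber (Γ-mℤ m) 1 × HasIndepNumber (Γ-ℤmod m) 1
  primeSquare (p , p-prime , refl) = Γ-mℤ-hasIndepNumber1 , Γ-ℤmod-hasIndepNumber1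
    where open PrimeSquare p-prime

  notPrimeSquare : ¬ (∃[ p ] (Prime p × m ≡ p * p)) → HasInfiniteIndepSet (Γ-mℤ m) × ∃[ n ] HasIndepNumber (Γ-ℤmod m) n
  notPrimeSquare m≢p*p with composite∧≢p*p⇒split m-composite m≢p*p
  ... | q , d , m≡q*d , m∤q , m∤d*d = Γ-mℤ-infiniteIndepSet q d m≡q*d m∤q m∤d*d , Γ-ℤmod-hasIndepNumber m
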